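{- Let $\lambda/\mu$ be a connected skew shape with Lascoux–Pragacz decomposition $(\theta_1,\dots,\theta_k)$. An SSYT $T$ of shape $\lambda/\mu$ lies in $\mathrm{SSYT}_{\min}(\lambda/\mu)$ if and only if (i) for every $r$ and every cell $(i,j)$ of $\theta_r$, $T(i,j)\le ht_{\theta_r}(i)$; and (ii) whenever $(i,j)$ and $(i+1,j)$ both belong to the same strip $\theta_r$, $T(i+1,j)-T(i,j)=1$.
   Context: $[\lambda]=\{(i,j):1\le i\le\ell(\lambda),1\le j\le\lambda_i\}$ (English convention), $\lambda'$ conjugate, $[\lambda/\mu]=[\lambda]\setminus[\mu]$, assumed connected. An SSYT of shape $\lambda/\mu$ is a filling of $[\lambda/\mu]$ by nonnegative integers weakly increasing in rows and strictly increasing down columns. Lascoux–Pragacz decomposition: a border strip is a connected skew shape with no $2\times2$ square. For $\varepsilon\ge0$ let $L_\varepsilon=\{(i,j)\in[\lambda/\mu]:(i+\varepsilon,j+\varepsilon)\in[\lambda/\mu],(i+\varepsilon+1,j+\varepsilon+1)\notin[\lambda]\}$; the connected components of all the $L_\varepsilon$, listed in decreasing order of the content $j-i$ of their north-east-most cell, are $\theta_1,\dots,\theta_k$. $\mathsf f(\theta_r)$ is the row of the NE-most cell of $\theta_r$ and $ht_{\theta_r}(i)=i-\mathsf f(\theta_r)$; $\theta_r(j)$ is the set of cells of $\theta_r$ in column $j$. Minimal SSYT: $T_0(i,j)=i-\mu'_j-1$. For an SSYT $T$, a nonempty $\theta_k(j)$ with top cell $(i,j)$ and bottom cell $(i',j)$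 is active if (a) $T(i,j)<ht_{\theta_k}(i)$ and (b) $T(i,j)<T(i,j+1)$ and $T(i',j)<T(i'+1,j)-1$ (each imposed when the relevant cell lies in $[\lambda/\mu]$). The move $\delta_{(k;j)}$ adds $1$ to every entry of an active $\theta_k(j)$. $\mathrm{SSYT}_{\min}(\lambda/\mu)$ is the set of tableaux obtained from $T_0$ by finite sequences of such moves. -}

module Defs where

open import Data.Nat using (ℕ; zero; suc; _+_; _∸_; _≤_; _<_; _≤?_)
open import Data.List using (List; []; _∷_; length; filter)
open import Data.Product using (_×_; _,_; Σ; ∃; ∃-syntax)
open import Relation.Nullary using (¬_)
open import Relation.Binary.PropositionalEquality using (_≡_)

-- Cells (i , j) : row i, column j, 1-indexed, English convention.
Cell : Set
Cell = ℕ × ℕ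

row : Cell → ℕ
row (i , _) = i

col : Cell → ℕ
col (_ , j) = j

-- A tableau: a filling by nonnegative integers; only values on cells of the
-- skew shape are relevant.
Tab : Set
Tab = ℕ → ℕ → ℕ

nth : List ℕ → ℕ → ℕ
nth []       _       = 0
nth (x ∷ _)  zero    = x
nth (_ ∷ xs) (suc n) = nth xs n

-- part λ i = λ_i (1-indexed; 0 beyond the length)
part : List ℕ → ℕ → ℕ
part l zero    = 0
part l (suc i) = nth l i

data Partition : List ℕ → Set where
  []  : Partition []
  [_] : (x : ℕ) → Partition (x ∷ [])
  _∷_ : ∀ {x y ys} → y ≤ x → Partition (y ∷ ys) → Partition (x ∷ y ∷ ys)

_⊆ₚ_ : List ℕ → List ℕ → Set
mu ⊆ₚ la = ∀ i → part mu i ≤ part la i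

conj : List ℕ → ℕ → ℕ
conj l j = length (filter (λ x → j ≤? x) l)

InDiag : List ℕ → Cell → Set
InDiag la (i , j) = (1 ≤ i) × (1 ≤ j) × (j ≤ part la i)

InSkew : List ℕ → List ℕ → Cell → Set
InSkew la mu c = InDiag la c × ¬ InDiag mu c

data Adj : Cell → Cell → Set where
  right : ∀ {i j} → Adj (i , j) (i , suc j)
  left  : ∀ {i j} → Adj (i , suc j) (i , j)
  down  : ∀ {i j} → Adj (i , j) (suc i , j)
  up    : ∀ {i j} → Adj (suc i , j) (i , j)

data Conn (P : Cell → Set) : Cell → Cell → Set where
  here : ∀ {c} → P c → Conn P c c
  step : ∀ {c d e} → Conn P c d → P e → Adj d e → Conn P c e

ConnectedSkew : List ℕ → List ℕ → Set
ConnectedSkew la mu =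
  ∀ c d → InSkew la mu c → InSkew la mu d → Conn (InSkew la mu) c d

IsSSYT : List ℕ → List ℕ → Tab → Set
IsSSYT la mu T =
  (∀ i j j' → InSkew la mu (i , j) → InSkew la mu (i , j') → j ≤ j' → T i j ≤ T i j')
  × (∀ i i' j → InSkew la mu (i , j) → InSkew la mu (i' , j) → i < i' → T i j < T i' j)

InL : List ℕ → List ℕ → ℕ → Cell → Set
InL la mu ε (i , j) =
  InSkew la mu (i , j) × InSkew la mu (i + ε , j + ε)
  × ¬ InDiag la (suc (i + ε) , suc (j + ε))

-- d lies in the same Lascoux–Pragacz strip θ as c
-- (the strips are the connected components of the L_ε)
SameStrip : List ℕ → List ℕ → Cell → Cell → Set
SameStrip la mu c d = ∃[ ε ] Conn (InL la mu ε) c d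

-- d is the north-east-most cell (maximal content j - i) of the strip of c
IsNE : List ℕ → List ℕ → Cell → Cell → Set
IsNE la mu c d =
  SameStrip la mu c d
  × (∀ e → SameStrip la mu c e → col e + row d ≤ col d + row e)

T₀ : List ℕ → Tab
T₀ mu i j = i ∸ conj mu j ∸ 1

-- θ(j) (θ = strip of c) is nonempty and active for T, with top cell (i,j)
-- and bottom cell (i',j)
Active : List ℕ → List ℕ → Tab → Cell → ℕ → Set
Active la mu T c j =
  ∃[ i ] ∃[ i' ]
    SameStrip la mu c (i , j) × SameStrip la mu c (i' , j)
    × (∀ i'' → SameStrip la mu c (i'' , j) → (i ≤ i'') × (i'' ≤ i'))
    -- (a)  T(i,j) < ht_θ(i) = i - f(θ)
    × (∀ d → IsNE la mu c d → T i j + row d < i)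
    × (InSkew la mu (i , suc j) → T i j < T i (suc j))
    × (InSkew la mu (suc i' , j) → suc (T i' j) < T (suc i') j)

-- T' = δ_(θ;j) T  (on the cells of λ/μ), with θ(j) active for T
Move : List ℕ → List ℕ → Tab → Tab → Set
Move la mu T T' =
  ∃[ c ] ∃[ j ]
    Active la mu T c j
    × (∀ i j' → InSkew la mu (i , j') →
         ((SameStrip la mu c (i , j') × j' ≡ j) → T' i j' ≡ suc (T i j'))
         × (¬ (SameStrip la mu c (i , j') × j' ≡ j) → T' i j' ≡ T i j'))

-- SSYT_min(λ/μ): tableaux reachable from T₀ by finitely many moves
-- (tableaux identified when they agree on the cells of λ/μ)
data SSYTmin (la mu : List ℕ) : Tab → Set where
  base : ∀ {T} → (∀ i j → InSkew la mu (i , j) → T i j ≡ T₀ mu i j) → SSYTmin la mu T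
  move : ∀ {T T'} → SSYTmin la mu T → Move la mu T T' → SSYTmin la mu T'

-- condition (i): T(i,j) ≤ ht_θ(i) = i - f(θ)
CondI : List ℕ → List ℕ → Tab → Set
CondI la mu T =
  ∀ c d → InSkew la mu c → IsNE la mu c d → T (row c) (col c) + row d ≤ row c

CondII : List ℕ → List ℕ → Tab → Set
CondII la mu T =
  ∀ i j → SameStrip la mu (i , j) (suc i , j) → T (suc i) j ≡ suc (T i j)

-- Condition (ii) says that T − T₀ is constant on each column θ(j) of a strip. The minimal
-- tableau satisfies (i) and (ii): the NE-most cell of the strip through (a,b) lies at most
-- one row below μ'_b, so ht ≥ a − μ'_b − 1 = T₀(a,b). A move raises a whole θ(j) by one,
-- which keeps (ii), and activity condition (a) at the top cell of θ(j) propagates (i) down θ(j).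
-- Conversely, if T satisfies (i) and (ii) but T ≠ T₀, let j be the leftmost column where T
-- exceeds T₀ and (i,j) the topmost such cell. By (ii) T exceeds T₀ on all of θ(j), so (i,j) is
-- its top; lowering θ(j) by one keeps T semistandard (by the minimality of j and i) and keeps
-- (i) and (ii), and the move δ_(θ;j), active by (i), recovers T. Induction on the sum of the
-- entries of T finishes the proof.
module Submission where

open import Defs
open import Data.Nat
open import Data.Nat.Properties
open import Data.List using (List; []; _∷_; length)
open import Data.List.Properties using (filter-accept; filter-reject)
open import Data.Product
open import Data.Sum using (_⊎_; inj₁; inj₂)
open import Data.Empty using (⊥-elim)
open import Relation.Nullary
open import Relation.Nullary.Decidable using (_×-dec_; ¬?; toSum)
open import Relation.Unary using (Decidable)
open import Relation.Binary.PropositionalEquality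
open import Algebra.Properties.CommutativeSemigroup +-commutativeSemigroup using (xy∙z≈xz∙y)
open import Function.Base using (_∘′_; case_of_)
open import Function.Bundles using (_⇔_; mk⇔; Equivalence)

nth-antitone : ∀ {l} → Partition l → ∀ {k k'} → k ≤ k' → nth l k' ≤ nth l k
nth-antitone []        _                 = z≤n
nth-antitone [ x ]     {zero} {zero}   _ = ≤-refl
nth-antitone [ x ]     {_}    {suc _}  _ = z≤n
nth-antitone (_ ∷ p)   {zero} {zero}   _ = ≤-refl
nth-antitone (y≤x ∷ p) {zero} {suc k'} _ = ≤-trans (nth-antitone p {0} {k'} z≤n) y≤x
nth-antitone (_ ∷ p)   {suc k} {suc k'} (s≤s k≤k') = nth-antitone p k≤k'

part-antitone : ∀ {l} → Partition l → ∀ {i i'} → 1 ≤ i → i ≤ i' → part l i' ≤ part l i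
part-antitone p {suc i} {suc i'} _ (s≤s i≤i') = nth-antitone p i≤i'

InDiag-downClosed : ∀ {la} → Partition la → ∀ {i j i' j'} → InDiag la (i , j) →
                    1 ≤ i' → 1 ≤ j' → i' ≤ i → j' ≤ j → InDiag la (i' , j')
InDiag-downClosed p (_ , _ , j≤λᵢ) 1≤i' 1≤j' i'≤i j'≤j =
  1≤i' , 1≤j' , ≤-trans j'≤j (≤-trans j≤λᵢ (part-antitone p 1≤i' i'≤i))

InDiag? : ∀ la c → Dec (InDiag la c)
InDiag? la (i , j) = (1 ≤? i) ×-dec ((1 ≤? j) ×-dec (j ≤? part la i))

InSkew? : ∀ la mu c → Dec (InSkew la mu c)
InSkew? la mu c = InDiag? la c ×-dec ¬? (InDiag? mu c)

InL? : ∀ la mu ε c → Dec (InL la mu ε c)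
InL? la mu ε (i , j) =
  InSkew? la mu (i , j) ×-dec (InSkew? la mu (i + ε , j + ε) ×-dec ¬? (InDiag? la (suc (i + ε) , suc (j + ε))))

conj-∷-accept : ∀ {x j} xs → j ≤ x → conj (x ∷ xs) j ≡ suc (conj xs j)
conj-∷-accept {j = j} _ j≤x = cong length (filter-accept (j ≤?_) j≤x)

conj-∷-reject : ∀ {x j} xs → j ≰ x → conj (x ∷ xs) j ≡ conj xs j
conj-∷-reject {j = j} _ j≰x = cong length (filter-reject (j ≤?_) j≰x)

conj-antitone : ∀ l {j j'} → j ≤ j' → conj l j' ≤ conj l j
conj-antitone [] _ = z≤n
conj-antitone (x ∷ xs) {j} {j'} j≤j' with j' ≤? x | j ≤? x
... | yes j'≤x | yes j≤x rewrite conj-∷-accept xs j'≤x | conj-∷-accept xs j≤x = s≤s (conj-antitone xs j≤j')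
... | yes j'≤x | no j≰x  = ⊥-elim (j≰x (≤-trans j≤j' j'≤x))
... | no j'≰x  | yes j≤x rewrite conj-∷-reject xs j'≰x | conj-∷-accept xs j≤x = m≤n⇒m≤1+n (conj-antitone xs j≤j')
... | no j'≰x  | no j≰x  rewrite conj-∷-reject xs j'≰x | conj-∷-reject xs j≰x = conj-antitone xs j≤j'

Partition-tail : ∀ {x xs} → Partition (x ∷ xs) → Partition xs
Partition-tail [ _ ]   = []
Partition-tail (_ ∷ p) = p

≤part⇒≤conj : ∀ {l} → Partition l → ∀ {i j} → 1 ≤ i → 1 ≤ j → j ≤ part l i → i ≤ conj l j
≤part⇒≤conj {[]}     _ {suc _} _ 1≤j j≤0 = ⊥-elim (<-irrefl refl (≤-trans 1≤j j≤0))
≤part⇒≤conj {x ∷ xs} p {suc i} {j} _ 1≤j j≤part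
  rewrite conj-∷-accept xs (≤-trans j≤part (nth-antitone p {0} {i} z≤n)) with i
... | zero   = s≤s z≤n
... | suc i' = s≤s (≤part⇒≤conj (Partition-tail p) {suc i'} (s≤s z≤n) 1≤j j≤part)

≤conj⇒≤part : ∀ {l} → Partition l → ∀ {i j} → 1 ≤ i → i ≤ conj l j → j ≤ part l i
≤conj⇒≤part {[]}     _ {suc _} _ ()
≤conj⇒≤part {x ∷ xs} p {suc i} {j} _ i<conj with j ≤? x
... | no j≰x = ⊥-elim (j≰x (≤-trans j≤part (nth-antitone p {0} {suc i} z≤n)))
  where
    j≤part : j ≤ part xs (suc i)
    j≤part = ≤conj⇒≤part (Partition-tail p) (s≤s z≤n) (subst (suc i ≤_) (conj-∷-reject xs j≰x) i<conj)
... | yes j≤x with i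
...   | zero   = j≤x
...   | suc i' = ≤conj⇒≤part (Partition-tail p) (s≤s z≤n) (s≤s⁻¹ (subst (suc (suc i') ≤_) (conj-∷-accept xs j≤x) i<conj))

T₀≡row∸ : ∀ mu a j → T₀ mu a j ≡ a ∸ suc (conj mu j)
T₀≡row∸ mu a j = trans (∸-+-assoc a (conj mu j) 1) (cong (a ∸_) (+-comm (conj mu j) 1))

T₀-row-monotone : ∀ mu a {j j'} → j ≤ j' → T₀ mu a j ≤ T₀ mu a j'
T₀-row-monotone mu a j≤j' = ∸-monoˡ-≤ 1 (∸-monoʳ-≤ a (conj-antitone mu j≤j'))

module _ {la mu : List ℕ} (pmu : Partition mu) where

  conj<row : ∀ {a j} → InSkew la mu (a , j) → conj mu j < a
  conj<row {a} {j} ((1≤a , 1≤j , _) , ∉μ) =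
    ≰⇒> (λ a≤conj → ∉μ (1≤a , 1≤j , ≤conj⇒≤part pmu 1≤a a≤conj))

  T₀+1+conj≡row : ∀ {a j} → InSkew la mu (a , j) → T₀ mu a j + suc (conj mu j) ≡ a
  T₀+1+conj≡row {a} {j} s = trans (cong (_+ suc (conj mu j)) (T₀≡row∸ mu a j)) (m∸n+n≡m (conj<row s))

  T₀-column-+ : ∀ {a j} k → InSkew la mu (a , j) → T₀ mu (a + k) j ≡ T₀ mu a j + k
  T₀-column-+ {a} {j} k s = begin
    T₀ mu (a + k) j           ≡⟨ T₀≡row∸ mu (a + k) j ⟩
    (a + k) ∸ suc (conj mu j) ≡⟨ +-∸-comm k (conj<row s) ⟩
    a ∸ suc (conj mu j) + k   ≡⟨ cong (_+ k) (T₀≡row∸ mu a j) ⟨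
    T₀ mu a j + k             ∎ where open ≡-Reasoning

  T₀-column-suc : ∀ {a j} → InSkew la mu (a , j) → T₀ mu (suc a) j ≡ suc (T₀ mu a j)
  T₀-column-suc {a} {j} s = trans (cong (λ r → T₀ mu r j) (+-comm 1 a)) (trans (T₀-column-+ 1 s) (+-comm _ 1))

  T₀-column-< : ∀ {a a' j} → InSkew la mu (a , j) → a < a' → T₀ mu a j < T₀ mu a' j
  T₀-column-< {a} {a'} {j} s a<a' =
    subst₂ _<_ (sym (T₀≡row∸ mu a j)) (sym (T₀≡row∸ mu a' j)) (∸-monoˡ-< a<a' (conj<row s))

nth>0⇒<length : ∀ l k → 1 ≤ nth l k → k < length l
nth>0⇒<length (_ ∷ _) zero    _ = s≤s z≤n
nth>0⇒<length (_ ∷ l) (suc k) h = s≤s (nth>0⇒<length l k h)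

size : List ℕ → ℕ
size la = length la + nth la 0

InDiag⇒≤size : ∀ {la} → Partition la → ∀ {i j} → InDiag la (i , j) → i ≤ size la × j ≤ size la
InDiag⇒≤size {la} p {suc i} (_ , 1≤j , j≤λᵢ) =
  ≤-trans (nth>0⇒<length la i (≤-trans 1≤j j≤λᵢ)) (m≤m+n _ _) ,
  ≤-trans j≤λᵢ (≤-trans (nth-antitone p {0} {i} z≤n) (m≤n+m _ _))

Adj-sym : ∀ {c d} → Adj c d → Adj d c
Adj-sym right = left
Adj-sym left  = right
Adj-sym down  = up
Adj-sym up    = down

module _ {P : Cell → Set} where

  Conn-source : ∀ {c d} → Conn P c d → P c
  Conn-source (here pc)     = pc
  Conn-source (step p _ _)  = Conn-source p

  Conn-target : ∀ {c d} → Conn P c d → P d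
  Conn-target (here pc)     = pc
  Conn-target (step _ pe _) = pe

  Conn-trans : ∀ {c d e} → Conn P c d → Conn P d e → Conn P c e
  Conn-trans p (here _)     = p
  Conn-trans p (step q x a) = step (Conn-trans p q) x a

  Conn-sym : ∀ {c d} → Conn P c d → Conn P d c
  Conn-sym (here pc)     = here pc
  Conn-sym (step p pe a) = Conn-trans (step (here pe) (Conn-target p) (Adj-sym a)) (Conn-sym p)

module _ {P : ℕ → Set} (P? : Decidable P) where

  least : ∀ {n} → P n → ∃ λ m → P m × (∀ {k} → k < m → ¬ P k)
  least {n} pn = leastBelow (suc n) (n , ≤-refl , pn)
    where
    leastBelow : ∀ b → (∃ λ k → k < b × P k) → ∃ λ m → P m × (∀ {k} → k < m → ¬ P k)
    leastBelow (suc b) w with anyUpTo? P? b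
    ... | yes w' = leastBelow b w'
    ... | no none with w
    ...   | k , k<1+b , pk with m≤n⇒m<n∨m≡n (s≤s⁻¹ k<1+b)
    ...     | inj₁ k<b  = ⊥-elim (none (k , k<b , pk))
    ...     | inj₂ refl = k , pk , λ k'<k pk' → none (_ , k'<k , pk')

  greatest : ∀ {b} → (∀ {k} → P k → k < b) → ∀ {n} → P n → ∃ λ m → P m × (∀ {k} → P k → k ≤ m)
  greatest {b} bounded pn =
    map₂ (map₂ (λ max pk → max pk (bounded pk))) (greatestBelow b pn (bounded pn))
    where
    greatestBelow : ∀ b {n} → P n → n < b → ∃ λ m → P m × (∀ {k} → P k → k < b → k ≤ m)
    greatestBelow (suc b) {n} pn n<1+b with P? b
    ... | yes pb = b , pb , λ _ k<1+b → s≤s⁻¹ k<1+b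
    ... | no ¬pb with m≤n⇒m<n∨m≡n (s≤s⁻¹ n<1+b)
    ...   | inj₂ refl = ⊥-elim (¬pb pn)
    ...   | inj₁ n<b  = map₂ (map₂ extend) (greatestBelow b pn n<b)
      where
      extend : ∀ {m} → (∀ {k} → P k → k < b → k ≤ m) → ∀ {k} → P k → k < suc b → k ≤ m
      extend max {k} pk k<1+b with m≤n⇒m<n∨m≡n (s≤s⁻¹ k<1+b)
      ... | inj₁ k<b  = max pk k<b
      ... | inj₂ refl = ⊥-elim (¬pb pk)

module Strips {la mu : List ℕ} (pla : Partition la) (pmu : Partition mu) where

  L : ℕ → Cell → Set
  L = InL la mu

  InSkew-column-convex : ∀ {a₁ a₂ a j} → InSkew la mu (a₁ , j) → InSkew la mu (a₂ , j) →
                         a₁ ≤ a → a ≤ a₂ → InSkew la mu (a , j)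
  InSkew-column-convex ((1≤a₁ , 1≤j , _) , ∉μ₁) (∈λ₂ , _) a₁≤a a≤a₂ =
    InDiag-downClosed pla ∈λ₂ (≤-trans 1≤a₁ a₁≤a) 1≤j a≤a₂ ≤-refl ,
    λ ∈μ → ∉μ₁ (InDiag-downClosed pmu ∈μ 1≤a₁ 1≤j a₁≤a ≤-refl)

  L-column-convex : ∀ {e a₁ a₂ a j} → L e (a₁ , j) → L e (a₂ , j) → a₁ ≤ a → a ≤ a₂ → L e (a , j)
  L-column-convex {e} (s₁ , s₁ᵉ , ∉λ₁) (s₂ , s₂ᵉ , _) a₁≤a a≤a₂ =
    InSkew-column-convex s₁ s₂ a₁≤a a≤a₂ ,
    InSkew-column-convex s₁ᵉ s₂ᵉ (+-monoˡ-≤ e a₁≤a) (+-monoˡ-≤ e a≤a₂) ,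
    λ ∈λ → ∉λ₁ (InDiag-downClosed pla ∈λ (s≤s z≤n) (s≤s z≤n) (s≤s (+-monoˡ-≤ e a₁≤a)) ≤-refl)

  -- If ε < ε', the ε'-diagonal translate of the cell lies in [λ] and dominates the
  -- ε-translate shifted by (1,1), which membership in L_ε puts outside [λ].
  L-≮ : ∀ {e e' c} → L e c → L e' c → e ≮ e'
  L-≮ {e} {e'} {i , j} (_ , _ , ∉λ) (_ , (∈λ , _) , _) e<e' =
    ∉λ (InDiag-downClosed pla ∈λ (s≤s z≤n) (s≤s z≤n)
          (subst (_≤ i + e') (+-suc i e) (+-monoʳ-≤ i e<e'))
          (subst (_≤ j + e') (+-suc j e) (+-monoʳ-≤ j e<e')))

  L-unique : ∀ {e e' c} → L e c → L e' c → e ≡ e'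
  L-unique h h' = ≤-antisym (≮⇒≥ (L-≮ h' h)) (≮⇒≥ (L-≮ h h'))

  L-column-Conn : ∀ {e a₁ a₂ j} → L e (a₁ , j) → L e (a₂ , j) → a₁ ≤ a₂ → Conn (L e) (a₁ , j) (a₂ , j)
  L-column-Conn h₁ h₂ a₁≤a₂ with m≤n⇒m<n∨m≡n a₁≤a₂
  ... | inj₂ refl         = here h₁
  ... | inj₁ (s≤s a₁≤a₂') =
    step (L-column-Conn h₁ (L-column-convex h₁ h₂ a₁≤a₂' (n≤1+n _)) a₁≤a₂') h₂ down

  SameStrip-column : ∀ {e a₁ a₂ j} → L e (a₁ , j) → L e (a₂ , j) → SameStrip la mu (a₁ , j) (a₂ , j)
  SameStrip-column h₁ h₂ with ≤-total _ _
  ... | inj₁ a₁≤a₂ = _ , L-column-Conn h₁ h₂ a₁≤a₂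
  ... | inj₂ a₂≤a₁ = _ , Conn-sym (L-column-Conn h₂ h₁ a₂≤a₁)

  SameStrip-L : ∀ {e c d} → L e c → SameStrip la mu c d → L e d
  SameStrip-L h (_ , p) = subst (λ e → L e _) (L-unique (Conn-source p) h) (Conn-target p)

  SameStrip-sym : ∀ {c d} → SameStrip la mu c d → SameStrip la mu d c
  SameStrip-sym (e , p) = e , Conn-sym p

  SameStrip-trans : ∀ {c d f} → SameStrip la mu c d → SameStrip la mu d f → SameStrip la mu c f
  SameStrip-trans (e , p) (e' , q) with L-unique (Conn-target p) (Conn-source q)
  ... | refl = e , Conn-trans p q

  diagonal-shift<size : ∀ {i j k} → InDiag la (i + k , j + k) → k < suc (size la)
  diagonal-shift<size {i} {k = k} ∈λᵏ = s≤s (≤-trans (m≤n+m k i) (proj₁ (InDiag⇒≤size pla ∈λᵏ)))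

  -- ε is the largest shift keeping the diagonal translate of the cell inside [λ].
  L-exists : ∀ {i j} → InSkew la mu (i , j) → ∃ λ e → L e (i , j)
  L-exists {i} {j} s@(∈λ , _)
    with greatest (λ e → InDiag? la (i + e , j + e)) diagonal-shift<size
                  (subst₂ (λ a b → InDiag la (a , b)) (sym (+-identityʳ i)) (sym (+-identityʳ j)) ∈λ)
  ... | e , ∈λᵉ , max = e , s , (∈λᵉ , ∉μᵉ) , ∉λ
    where
    ∉μᵉ : ¬ InDiag mu (i + e , j + e)
    ∉μᵉ ∈μᵉ = proj₂ s (InDiag-downClosed pmu ∈μᵉ (proj₁ ∈λ) (proj₁ (proj₂ ∈λ)) (m≤m+n i e) (m≤m+n j e))
    ∉λ : ¬ InDiag la (suc (i + e) , suc (j + e))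
    ∉λ ∈λ' = <-irrefl refl (max (subst₂ (λ a b → InDiag la (a , b)) (sym (+-suc i e)) (sym (+-suc j e)) ∈λ'))

  -- The cells of L_ε in one column form an interval, hence lie in one strip θ:
  -- this is θ(j) for the strip θ ⊆ L_ε meeting column j.
  Seg : ℕ → ℕ → Cell → Set
  Seg e j (a , j') = j' ≡ j × L e (a , j')

  Seg? : ∀ e j c → Dec (Seg e j c)
  Seg? e j (a , j') = (j' ≟ j) ×-dec InL? la mu e (a , j')

  SameStrip-Seg : ∀ {e j c d} → L e c → SameStrip la mu c d × col d ≡ j → Seg e j d
  SameStrip-Seg h (ss , refl) = refl , SameStrip-L h ss

  Seg-SameStrip : ∀ {e i j c} → L e (i , j) → Seg e j c → SameStrip la mu (i , j) c × col c ≡ j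
  Seg-SameStrip hᵢ (refl , h) = SameStrip-column hᵢ h , refl

  Raise : ℕ → ℕ → Tab → Tab → Set
  Raise e j T T' = ∀ a j' → InSkew la mu (a , j') →
    (Seg e j (a , j') → T' a j' ≡ suc (T a j')) × (¬ Seg e j (a , j') → T' a j' ≡ T a j')

  -- Vertically adjacent cells of one strip are both in θ(j) or both outside it.
  Raise-vertical : ∀ {e j T T' a j'} → Raise e j T T' → SameStrip la mu (a , j') (suc a , j') →
                   (T' (suc a) j' ≡ suc (T' a j') ⇔ T (suc a) j' ≡ suc (T a j'))
  Raise-vertical {e} {j} {T} {T'} {a} {j'} raise ss@(_ , p) with Seg? e j (a , j')
  ... | yes (refl , h) = mk⇔ (λ eq → suc-injective (trans (sym below) (trans eq (cong suc above))))
                            (λ eq → trans below (trans (cong suc eq) (cong suc (sym above))))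
    where
    above : T' a j ≡ suc (T a j)
    above = proj₁ (raise a j (proj₁ h)) (refl , h)
    below : T' (suc a) j ≡ suc (T (suc a) j)
    below = proj₁ (raise (suc a) j (proj₁ (Conn-target p))) (refl , SameStrip-L h ss)
  ... | no ¬seg = mk⇔ (λ eq → trans (sym below) (trans eq (cong suc above)))
                      (λ eq → trans below (trans eq (cong suc (sym above))))
    where
    above : T' a j' ≡ T a j'
    above = proj₂ (raise a j' (proj₁ (Conn-source p))) ¬seg
    below : T' (suc a) j' ≡ T (suc a) j'
    below = proj₂ (raise (suc a) j' (proj₁ (Conn-target p)))
              (λ { (refl , h) → ¬seg (refl , SameStrip-L h (SameStrip-sym ss)) })

  Raise-CondII : ∀ {e j T T'} → Raise e j T T' → CondII la mu T ⇔ CondII la mu T'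
  Raise-CondII raise =
    mk⇔ (λ c2 a j' ss → Equivalence.from (Raise-vertical raise ss) (c2 a j' ss))
        (λ c2 a j' ss → Equivalence.to (Raise-vertical raise ss) (c2 a j' ss))

  CondII-column-+ : ∀ {T e a j} → CondII la mu T → L e (a , j) → ∀ k → L e (a + k , j) →
                    T (a + k) j ≡ T a j + k
  CondII-column-+ {T} {e} {a} {j} _  _ zero    _  = trans (cong (λ r → T r j) (+-identityʳ a)) (sym (+-identityʳ _))
  CondII-column-+ {T} {e} {a} {j} c2 h (suc k) h' = begin
    T (a + suc k) j   ≡⟨ cong (λ r → T r j) (+-suc a k) ⟩
    T (suc (a + k)) j ≡⟨ c2 (a + k) j (SameStrip-column middle h'') ⟩
    suc (T (a + k) j) ≡⟨ cong suc (CondII-column-+ c2 h k middle) ⟩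
    suc (T a j + k)   ≡⟨ +-suc _ k ⟨
    T a j + suc k     ∎
    where
    open ≡-Reasoning
    h'' : L e (suc (a + k) , j)
    h'' = subst (λ r → L e (r , j)) (+-suc a k) h'
    middle : L e (a + k , j)
    middle = L-column-convex h h'' (m≤m+n a k) (n≤1+n _)

AgreesWithT₀ : List ℕ → List ℕ → Tab → Set
AgreesWithT₀ la mu T = ∀ i j → InSkew la mu (i , j) → T i j ≡ T₀ mu i j

module Forward {la mu : List ℕ} (pla : Partition la) (pmu : Partition mu) where
  open Strips pla pmu

  IsNE-SameStrip : ∀ {c c' d} → SameStrip la mu c c' → IsNE la mu c' d → IsNE la mu c d
  IsNE-SameStrip ss (ss' , max) = SameStrip-trans ss ss' , λ f ssf → max f (SameStrip-trans (SameStrip-sym ss) ssf)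

  NE-col≥ : ∀ {a b f g} → IsNE la mu (a , b) (f , g) → b ≤ g
  NE-col≥ {a} {b} {f} {g} ((e , p) , max) = ≮⇒≥ λ g<b →
    proj₂ (proj₂ (Conn-target p))
      (InDiag-downClosed pla (proj₁ (proj₁ (proj₂ (Conn-source p)))) (s≤s z≤n) (s≤s z≤n)
        (+-monoˡ-≤ e (f<a g<b)) (+-monoˡ-≤ e g<b))
    where
    f<a : g < b → f < a
    f<a g<b = +-cancelˡ-≤ g (suc f) a (begin
      g + suc f ≡⟨ +-suc g f ⟩
      suc g + f ≤⟨ +-monoˡ-≤ f g<b ⟩
      b + f     ≤⟨ max (a , b) (e , here (Conn-source p)) ⟩
      g + a     ∎)
      where open ≤-Reasoning

  NE-no-right : ∀ {c f g} → IsNE la mu c (f , g) → ¬ SameStrip la mu c (f , suc g)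
  NE-no-right {f = f} {g} (_ , max) ss = <-irrefl refl (max (f , suc g) ss)

  NE-no-up : ∀ {c f g} → IsNE la mu c (suc f , g) → ¬ SameStrip la mu c (f , g)
  NE-no-up {f = f} {g} (_ , max) ss = <-irrefl refl (+-cancelˡ-≤ g _ _ (max (f , g) ss))

  L-extend-right : ∀ {e f g} → L e (f , g) → InDiag la (f + e , suc (g + e)) → L e (f , suc g)
  L-extend-right {e} {f} {g} ((∈λ , ∉μ) , _ , ∉λ⁺) ∈λʳ =
    (InDiag-downClosed pla ∈λʳ (proj₁ ∈λ) (s≤s z≤n) (m≤m+n f e) (s≤s (m≤m+n g e)) , ∉μ ∘′ left-of) ,
    (∈λʳ , ∉μ ∘′ left-of ∘′ λ ∈μ → InDiag-downClosed pmu ∈μ (proj₁ ∈λ) (s≤s z≤n) (m≤m+n f e) (s≤s (m≤m+n g e))) ,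
    λ ∈λ' → ∉λ⁺ (InDiag-downClosed pla ∈λ' (s≤s z≤n) (s≤s z≤n) ≤-refl (n≤1+n _))
    where
    left-of : InDiag mu (f , suc g) → InDiag mu (f , g)
    left-of ∈μ = InDiag-downClosed pmu ∈μ (proj₁ ∈λ) (proj₁ (proj₂ ∈λ)) ≤-refl (n≤1+n g)

  L-extend-up : ∀ {e f g} → L e (suc f , g) → 1 ≤ f → ¬ InDiag mu (f , g) →
                ¬ InDiag la (suc (f + e) , suc (g + e)) → L e (f , g)
  L-extend-up {e} {f} {g} ((∈λ , _) , (∈λᵉ , _) , _) 1≤f ∉μ ∉λ⁺ =
    (InDiag-downClosed pla ∈λ 1≤f 1≤g (n≤1+n f) ≤-refl , ∉μ) ,
    (InDiag-downClosed pla ∈λᵉ (≤-trans 1≤f (m≤m+n f e)) (≤-trans 1≤g (m≤m+n g e)) (n≤1+n _) ≤-refl ,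
     λ ∈μ → ∉μ (InDiag-downClosed pmu ∈μ 1≤f 1≤g (m≤m+n f e) (m≤m+n g e))) ,
    ∉λ⁺
    where
    1≤g : 1 ≤ g
    1≤g = proj₁ (proj₂ ∈λ)

  -- Unless the cell above the NE-most cell lies in [μ], the strip extends to the right or upwards.
  NE-row≤ : ∀ {a b f g} → InSkew la mu (a , b) → IsNE la mu (a , b) (f , g) → f ≤ suc (conj mu b)
  NE-row≤ {f = zero}        _ _ = z≤n
  NE-row≤ {f = suc zero}    _ _ = s≤s z≤n
  NE-row≤ {b = b} {f = suc (suc f)} {g} s ne@((e , p) , _)
    with InDiag? mu (suc f , g) | InDiag? la (suc (suc f) + e , suc (g + e))
  ... | yes ∈μ | _      = s≤s (≤part⇒≤conj pmu (s≤s z≤n) (proj₁ (proj₂ (proj₁ s))) (≤-trans (NE-col≥ ne) (proj₂ (proj₂ ∈μ))))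
  ... | no ∉μ  | yes ∈λ = ⊥-elim (NE-no-right ne (e , step p (L-extend-right (Conn-target p) ∈λ) right))
  ... | no ∉μ  | no ∉λ  = ⊥-elim (NE-no-up ne (e , step p (L-extend-up (Conn-target p) (s≤s z≤n) ∉μ ∉λ) up))

  T₀-CondI : ∀ {T} → AgreesWithT₀ la mu T → CondI la mu T
  T₀-CondI {T} agree (a , b) (f , g) s ne = begin
    T a b + f                 ≡⟨ cong (_+ f) (agree a b s) ⟩
    T₀ mu a b + f             ≤⟨ +-monoʳ-≤ _ (NE-row≤ s ne) ⟩
    T₀ mu a b + suc (conj mu b) ≡⟨ T₀+1+conj≡row pmu s ⟩
    a                         ∎ where open ≤-Reasoning

  T₀-CondII : ∀ {T} → AgreesWithT₀ la mu T → CondII la mu T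
  T₀-CondII {T} agree a b (_ , p) = begin
    T (suc a) b        ≡⟨ agree (suc a) b (proj₁ (Conn-target p)) ⟩
    T₀ mu (suc a) b    ≡⟨ T₀-column-suc pmu (proj₁ (Conn-source p)) ⟩
    suc (T₀ mu a b)    ≡⟨ cong suc (agree a b (proj₁ (Conn-source p))) ⟨
    suc (T a b)        ∎ where open ≡-Reasoning

  Move⇒Raise : ∀ {T T'} → Move la mu T T' → ∃₂ λ e j → Raise e j T T'
  Move⇒Raise (c , j , (i , _ , ssᵢ@(e , pᵢ) , _) , changes) =
    e , j , λ a j' s →
      (λ seg → proj₁ (changes a j' s) (map₁ (SameStrip-trans ssᵢ) (Seg-SameStrip (Conn-target pᵢ) seg))) ,
      (λ ¬seg → proj₂ (changes a j' s) (¬seg ∘′ SameStrip-Seg (Conn-source pᵢ)))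

  Move-CondII : ∀ {T T'} → Move la mu T T' → CondII la mu T → CondII la mu T'
  Move-CondII mv with Move⇒Raise mv
  ... | _ , _ , raise = Equivalence.to (Raise-CondII raise)

  -- On θ(j) the new entries are T(i,j) + k + 1 at height k below the top cell (i,j),
  -- so condition (i) there follows from activity condition (a) at (i,j).
  Move-CondI : ∀ {T T'} → Move la mu T T' → CondI la mu T → CondII la mu T → CondI la mu T'
  Move-CondI {T} {T'} (c , j , (i , _ , ssᵢ@(e , pᵢ) , _ , extent , below-ht , _) , changes) c1 c2 (a , j') d s ne
    with Seg? e j (a , j')
  ... | no ¬seg = subst (λ t → t + row d ≤ a) (sym (proj₂ (changes a j' s) (¬seg ∘′ SameStrip-Seg (Conn-source pᵢ))))
                        (c1 (a , j') d s ne)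
  ... | yes (refl , h) with SameStrip-trans ssᵢ (SameStrip-column (Conn-target pᵢ) h)
  ...   | ssₐ with m≤n⇒∃[o]m+o≡n (proj₁ (extent a ssₐ))
  ...     | k , refl = begin
    T' (i + k) j + row d    ≡⟨ cong (_+ row d) (trans raised (cong suc (CondII-column-+ c2 hᵢ k h))) ⟩
    suc (T i j + k) + row d ≡⟨ xy∙z≈xz∙y (suc (T i j)) k (row d) ⟩
    suc (T i j + row d) + k ≤⟨ +-monoˡ-≤ k (below-ht d (IsNE-SameStrip ssₐ ne)) ⟩
    i + k                   ∎
    where
    open ≤-Reasoning
    hᵢ : L e (i , j)
    hᵢ = Conn-target pᵢ
    raised : T' (i + k) j ≡ suc (T (i + k) j)
    raised = proj₁ (changes (i + k) j s) (ssₐ , refl)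

  SSYTmin⇒CondI×CondII : ∀ {T} → SSYTmin la mu T → CondI la mu T × CondII la mu T
  SSYTmin⇒CondI×CondII (base agree) = T₀-CondI agree , T₀-CondII agree
  SSYTmin⇒CondI×CondII (move d mv) with SSYTmin⇒CondI×CondII d
  ... | c1 , c2 = Move-CondI mv c1 c2 , Move-CondII mv c2

Σ< : ℕ → (ℕ → ℕ) → ℕ
Σ< zero    f = 0
Σ< (suc n) f = Σ< n f + f n

Σ<-mono : ∀ {f g} → (∀ k → f k ≤ g k) → ∀ n → Σ< n f ≤ Σ< n g
Σ<-mono f≤g zero    = z≤n
Σ<-mono f≤g (suc n) = +-mono-≤ (Σ<-mono f≤g n) (f≤g n)

Σ<-mono-< : ∀ {f g} → (∀ k → f k ≤ g k) → ∀ {k n} → k < n → f k < g k → Σ< n f < Σ< n g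
Σ<-mono-< f≤g {k} {suc n} k<1+n fk<gk with m≤n⇒m<n∨m≡n (s≤s⁻¹ k<1+n)
... | inj₁ k<n  = +-mono-<-≤ (Σ<-mono-< f≤g k<n fk<gk) (f≤g n)
... | inj₂ refl = +-mono-≤-< (Σ<-mono f≤g n) fk<gk

module Backward {la mu : List ℕ} (pla : Partition la) (pmu : Partition mu) where
  open Strips pla pmu

  Admissible : Tab → Set
  Admissible T = IsSSYT la mu T × CondI la mu T × CondII la mu T

  column-strict-+ : ∀ {T a j} → IsSSYT la mu T → InSkew la mu (a , j) → ∀ k → InSkew la mu (a + k , j) →
                    T a j + k ≤ T (a + k) j
  column-strict-+ {T} {a} {j} _ _ zero _ = ≤-reflexive (trans (+-identityʳ _) (cong (λ r → T r j) (sym (+-identityʳ a))))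
  column-strict-+ {T} {a} {j} ss s (suc k) s' = begin
    T a j + suc k       ≡⟨ +-suc _ k ⟩
    suc (T a j + k)     ≤⟨ s≤s (column-strict-+ ss s k middle) ⟩
    suc (T (a + k) j)   ≤⟨ proj₂ ss (a + k) (suc (a + k)) j middle s'' ≤-refl ⟩
    T (suc (a + k)) j   ≡⟨ cong (λ r → T r j) (+-suc a k) ⟨
    T (a + suc k) j     ∎
    where
    open ≤-Reasoning
    s'' : InSkew la mu (suc (a + k) , j)
    s'' = subst (λ r → InSkew la mu (r , j)) (+-suc a k) s'
    middle : InSkew la mu (a + k , j)
    middle = InSkew-column-convex s s'' (m≤m+n a k) (n≤1+n _)

  -- T₀(a,j) is the distance from the top cell (μ'_j + 1, j) of column j.
  T₀≤ : ∀ {T a j} → IsSSYT la mu T → InSkew la mu (a , j) → T₀ mu a j ≤ T a j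
  T₀≤ {T} {a} {j} ss s@((_ , 1≤j , _) , _) = begin
    T₀ mu a j                       ≤⟨ m≤n+m _ _ ⟩
    T top j + T₀ mu a j             ≤⟨ column-strict-+ ss s-top (T₀ mu a j) (subst (λ r → InSkew la mu (r , j)) (sym a≡) s) ⟩
    T (top + T₀ mu a j) j           ≡⟨ cong (λ r → T r j) a≡ ⟩
    T a j                           ∎
    where
    open ≤-Reasoning
    top : ℕ
    top = suc (conj mu j)
    a≡ : top + T₀ mu a j ≡ a
    a≡ = trans (+-comm top _) (T₀+1+conj≡row pmu s)
    s-top : InSkew la mu (top , j)
    s-top = InDiag-downClosed pla (proj₁ s) (s≤s z≤n) 1≤j (conj<row pmu s) ≤-refl ,
            λ ∈μ → <-irrefl refl (≤part⇒≤conj pmu (s≤s z≤n) 1≤j (proj₂ (proj₂ ∈μ)))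

  box : ℕ
  box = suc (size la)

  InSkew⇒<box : ∀ {a j} → InSkew la mu (a , j) → a < box × j < box
  InSkew⇒<box (∈λ , _) = map s≤s s≤s (InDiag⇒≤size pla ∈λ)

  weight : Tab → ℕ
  weight T = Σ< box (λ a → Σ< box (T a))

  -- Undoing a move: (i , j) is the topmost cell exceeding T₀ in the leftmost column j
  -- where T exceeds T₀, and θ(j) runs from row i down to row b.
  module Lowering {T : Tab} (ss : IsSSYT la mu T) (c2 : CondII la mu T) {e i j b : ℕ}
    (hᵢ : L e (i , j)) (exceedsᵢ : T₀ mu i j < T i j)
    (above-i : ∀ {a} → a < i → InSkew la mu (a , j) → T a j ≤ T₀ mu a j)
    (left-of-j : ∀ {a j'} → j' < j → InSkew la mu (a , j') → T a j' ≤ T₀ mu a j')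
    (h_b : L e (b , j)) (below-b : ∀ {a} → L e (a , j) → a ≤ b) where

    shift : ∀ {a} → L e (a , j) → ∀ k → L e (a + k , j) →
            T₀ mu (a + k) j ≡ T₀ mu a j + k × T (a + k) j ≡ T a j + k
    shift h k h' = T₀-column-+ pmu k (proj₁ h) , CondII-column-+ c2 h k h'

    θ-below-i : ∀ {a} → L e (a , j) → i ≤ a
    θ-below-i {a} h = ≮⇒≥ λ a<i → case m≤n⇒∃[o]m+o≡n (<⇒≤ a<i) of λ where
      (k , refl) → <⇒≱ (+-cancelʳ-< k _ _ (subst₂ _<_ (proj₁ (shift h k hᵢ)) (proj₂ (shift h k hᵢ)) exceedsᵢ))
                       (above-i a<i (proj₁ h))

    θ-exceeds : ∀ {a} → L e (a , j) → T₀ mu a j < T a j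
    θ-exceeds h with m≤n⇒∃[o]m+o≡n (θ-below-i h)
    ... | k , refl = subst₂ _<_ (sym (proj₁ (shift hᵢ k h))) (sym (proj₂ (shift hᵢ k h))) (+-monoˡ-< k exceedsᵢ)

    T↓ : Tab
    T↓ a j' with Seg? e j (a , j')
    ... | yes _ = pred (T a j')
    ... | no  _ = T a j'

    T↓≤T : ∀ a j' → T↓ a j' ≤ T a j'
    T↓≤T a j' with Seg? e j (a , j')
    ... | yes _ = pred[n]≤n
    ... | no  _ = ≤-refl

    T↓-raise : Raise e j T↓ T
    T↓-raise a j' _ with Seg? e j (a , j')
    ... | yes seg = (λ _ → suc∘pred seg) , λ ¬seg → ⊥-elim (¬seg seg)
      where
      suc∘pred : Seg e j (a , j') → T a j' ≡ suc (pred (T a j'))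
      suc∘pred (refl , h) = sym (suc-pred _ {{>-nonZero (m<n⇒0<n (θ-exceeds h))}})
    ... | no ¬seg = (λ seg → ⊥-elim (¬seg seg)) , λ _ → refl

    raised : ∀ {a} → L e (a , j) → T a j ≡ suc (T↓ a j)
    raised h = proj₁ (T↓-raise _ j (proj₁ h)) (refl , h)

    unchanged : ∀ {a j'} → InSkew la mu (a , j') → ¬ Seg e j (a , j') → T a j' ≡ T↓ a j'
    unchanged s = proj₂ (T↓-raise _ _ s)

    T↓-rows : ∀ a j₁ j₂ → InSkew la mu (a , j₁) → InSkew la mu (a , j₂) → j₁ ≤ j₂ → T↓ a j₁ ≤ T↓ a j₂
    T↓-rows a j₁ j₂ s₁ s₂ j₁≤j₂ with toSum (Seg? e j (a , j₂))
    ... | inj₂ ¬seg₂ = ≤-trans (T↓≤T a j₁) (subst (T a j₁ ≤_) (unchanged s₂ ¬seg₂) (proj₁ ss a j₁ j₂ s₁ s₂ j₁≤j₂))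
    ... | inj₁ (refl , h₂) with m≤n⇒m<n∨m≡n j₁≤j₂
    ...   | inj₂ refl = ≤-refl
    ...   | inj₁ j₁<j = s≤s⁻¹ (begin
      suc (T↓ a j₁)     ≡⟨ cong suc (unchanged s₁ (<⇒≢ j₁<j ∘′ proj₁)) ⟨
      suc (T a j₁)      ≤⟨ s≤s (left-of-j j₁<j s₁) ⟩
      suc (T₀ mu a j₁)  ≤⟨ s≤s (T₀-row-monotone mu a j₁≤j₂) ⟩
      suc (T₀ mu a j)   ≤⟨ θ-exceeds h₂ ⟩
      T a j             ≡⟨ raised h₂ ⟩
      suc (T↓ a j)      ∎)
      where open ≤-Reasoning

    T↓-columns : ∀ a₁ a₂ j' → InSkew la mu (a₁ , j') → InSkew la mu (a₂ , j') → a₁ < a₂ → T↓ a₁ j' < T↓ a₂ j'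
    T↓-columns a₁ a₂ j' s₁ s₂ a₁<a₂ with toSum (Seg? e j (a₁ , j')) | toSum (Seg? e j (a₂ , j'))
    ... | inj₁ (refl , h₁) | inj₁ (_ , h₂) =
      s<s⁻¹ (subst₂ _<_ (raised h₁) (raised h₂) (proj₂ ss a₁ a₂ j s₁ s₂ a₁<a₂))
    ... | inj₁ (refl , _)  | inj₂ ¬seg₂ =
      ≤-<-trans (T↓≤T a₁ j) (subst (T a₁ j <_) (unchanged s₂ ¬seg₂) (proj₂ ss a₁ a₂ j s₁ s₂ a₁<a₂))
    ... | inj₂ ¬seg₁ | inj₂ ¬seg₂ =
      subst₂ _<_ (unchanged s₁ ¬seg₁) (unchanged s₂ ¬seg₂) (proj₂ ss a₁ a₂ j' s₁ s₂ a₁<a₂)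
    ... | inj₂ ¬seg₁ | inj₁ (refl , h₂) = begin-strict
      T↓ a₁ j      ≡⟨ unchanged s₁ ¬seg₁ ⟨
      T a₁ j       ≤⟨ above-i a₁<i s₁ ⟩
      T₀ mu a₁ j   <⟨ T₀-column-< pmu s₁ a₁<a₂ ⟩
      T₀ mu a₂ j   ≤⟨ s≤s⁻¹ (subst (T₀ mu a₂ j <_) (raised h₂) (θ-exceeds h₂)) ⟩
      T↓ a₂ j      ∎
      where
      open ≤-Reasoning
      a₁<i : a₁ < i
      a₁<i = ≰⇒> λ i≤a₁ → ¬seg₁ (refl , L-column-convex hᵢ h₂ i≤a₁ (<⇒≤ a₁<a₂))

    T↓-SSYT : IsSSYT la mu T↓
    T↓-SSYT = T↓-rows , T↓-columns

    T↓-CondI : CondI la mu T → CondI la mu T↓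
    T↓-CondI c1 c@(a , j') d s ne = ≤-trans (+-monoˡ-≤ (row d) (T↓≤T a j')) (c1 c d s ne)

    T↓-CondII : CondII la mu T↓
    T↓-CondII = Equivalence.from (Raise-CondII T↓-raise) c2

    T↓-Move : CondI la mu T → Move la mu T↓ T
    T↓-Move c1 = (i , j) , j , (i , b , (e , here hᵢ) , SameStrip-column hᵢ h_b , extent , below-ht , right-ok , below-ok) ,
                 λ a j' s → (proj₁ (T↓-raise a j' s) ∘′ SameStrip-Seg hᵢ) ,
                            (λ ¬ss → proj₂ (T↓-raise a j' s) (¬ss ∘′ Seg-SameStrip hᵢ))
      where
      extent : ∀ a → SameStrip la mu (i , j) (a , j) → i ≤ a × a ≤ b
      extent a ss = θ-below-i (SameStrip-L hᵢ ss) , below-b (SameStrip-L hᵢ ss)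
      below-ht : ∀ d → IsNE la mu (i , j) d → T↓ i j + row d < i
      below-ht d ne = subst (λ t → t + row d ≤ i) (raised hᵢ) (c1 (i , j) d (proj₁ hᵢ) ne)
      right-ok : InSkew la mu (i , suc j) → T↓ i j < T↓ i (suc j)
      right-ok s = subst₂ _≤_ (raised hᵢ) (unchanged s λ { (j+1≡j , _) → 1+n≢n j+1≡j })
                     (proj₁ ss i j (suc j) (proj₁ hᵢ) s (n≤1+n j))
      below-ok : InSkew la mu (suc b , j) → suc (T↓ b j) < T↓ (suc b) j
      below-ok s = subst₂ _<_ (raised h_b) (unchanged s λ { (_ , h) → 1+n≰n (below-b h) })
                     (proj₂ ss b (suc b) j (proj₁ h_b) s ≤-refl)

    T↓-weight : weight T↓ < weight T
    T↓-weight = Σ<-mono-< (λ a → Σ<-mono (T↓≤T a) box) (proj₁ (InSkew⇒<box (proj₁ hᵢ)))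
                  (Σ<-mono-< (T↓≤T i) (proj₂ (InSkew⇒<box (proj₁ hᵢ))) (subst (T↓ i j <_) (sym (raised hᵢ)) ≤-refl))

  Exceeds : Tab → ℕ → ℕ → Set
  Exceeds T a j = InSkew la mu (a , j) × T₀ mu a j < T a j

  Exceeds? : ∀ T a j → Dec (Exceeds T a j)
  Exceeds? T a j = InSkew? la mu (a , j) ×-dec (T₀ mu a j <? T a j)

  ColumnExceeds? : ∀ T j → Dec (∃ λ a → a < box × Exceeds T a j)
  ColumnExceeds? T j = anyUpTo? (λ a → Exceeds? T a j) box

  descent : ∀ {T} → Admissible T →
            AgreesWithT₀ la mu T ⊎ ∃ λ T' → Admissible T' × Move la mu T' T × weight T' < weight T
  descent {T} (ss , c1 , c2) with anyUpTo? (ColumnExceeds? T) box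
  ... | no none = inj₁ λ a j s →
        ≤-antisym (≮⇒≥ λ lt → none (j , proj₂ (InSkew⇒<box s) , a , proj₁ (InSkew⇒<box s) , s , lt)) (T₀≤ ss s)
  ... | yes (_ , _ , exceeds) with least (ColumnExceeds? T) exceeds
  ... | j , (_ , _ , exceedsⱼ) , left-min with least (λ a → Exceeds? T a j) exceedsⱼ
  ... | i , (sᵢ , exceedsᵢ) , above-min with L-exists sᵢ
  ... | e , hᵢ with greatest (λ a → InL? la mu e (a , j)) (λ h → proj₁ (InSkew⇒<box (proj₁ h))) hᵢ
  ... | b , h_b , below-b =
        inj₂ (T↓ , (T↓-SSYT , T↓-CondI c1 , T↓-CondII) , T↓-Move c1 , T↓-weight)
    where
    above-i : ∀ {a} → a < i → InSkew la mu (a , j) → T a j ≤ T₀ mu a j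
    above-i a<i s = ≮⇒≥ λ lt → above-min a<i (s , lt)
    left-of-j : ∀ {a j'} → j' < j → InSkew la mu (a , j') → T a j' ≤ T₀ mu a j'
    left-of-j j'<j s = ≮⇒≥ λ lt → left-min j'<j (_ , proj₁ (InSkew⇒<box s) , s , lt)
    open Lowering ss c2 hᵢ exceedsᵢ above-i left-of-j h_b below-b

  Admissible⇒SSYTmin : ∀ {T} → Admissible T → SSYTmin la mu T
  Admissible⇒SSYTmin {T} = reach (suc (weight T)) ≤-refl
    where
    reach : ∀ n {T} → weight T < n → Admissible T → SSYTmin la mu T
    reach (suc n) w<n adm with descent adm
    ... | inj₁ agree = base agree
    ... | inj₂ (_ , adm' , mv , w'<w) = move (reach n (≤-trans w'<w (s≤s⁻¹ w<n)) adm') mv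

theorem3p9 : (la mu : List ℕ) → Partition la → Partition mu → mu ⊆ₚ la
    → ConnectedSkew la mu → (T : Tab) → IsSSYT la mu T
    → SSYTmin la mu T ⇔ (CondI la mu T × CondII la mu T)
theorem3p9 la mu pla pmu _ _ T ss =
  mk⇔ (Forward.SSYTmin⇒CondI×CondII pla pmu)
      (λ (c1 , c2) → Backward.Admissible⇒SSYTmin pla pmu (ss , c1 , c2))
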